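{- Let $P$ be a $j$-Sing poset of rank $d+1$. If $d$ is even, then \[ 2e_P(\hat0,\hat1)=-\sum_{t\in P,\ 1\le\rho(t)\le j}e_P(t,\hat1)-\sum_{t\in P,\ d-j+1\le\rho(t)\le d}e_P(\hat0,t). \] If $d$ is odd, then \[ \sum_{t\in P,\ 1\le\rho(t)\le j}e_P(t,\hat1)=\sum_{t\in P,\ d-j+1\le\rho(t)\le d}e_P(\hat0,t). \]
   Context: Posets are finite and graded with unique $\hat0$, $\hat1$, rank function $\rho$ ($\rho(\hat0)=0$) and Möbius function $\mu_P$; $e_P(s,t)=\mu_P(s,t)-(-1)^{\rho(t)-\rho(s)}$. Intervals are regarded as graded posets of rank equal to their length $\rho(t)-\rho(s)$. $P$ is Eulerian if $\mu_P(s,t)=(-1)^{\rho(t)-\rho(s)}$ for all $s\le t$, semi-Eulerian if this holds for all intervals other than $[\hat0,\hat1]$. For $P$ of rank $d+1$: $(-1)$-Sing means Eulerian, $0$-Sing means semi-Eulerian, and for $j\ge1$, $P$ is $j$-Sing if every interval of length $\le d$ is $(j-1)$-Sing. -}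

module Defs where

open import Level using (0ℓ)
open import Data.Nat using (ℕ; zero; suc; _≤_; _<_; _∸_; _≤?_; _<?_)
open import Data.Integer using (ℤ; +_; -_; _+_; _-_)
open import Data.Fin using (Fin; zero; suc)
open import Data.Fin.Properties using (_≟_)
open import Data.Bool using (Bool; true; false; if_then_else_; _∧_; not)
open import Data.Product using (_×_)
open import Data.Sum using (_⊎_)
open import Relation.Nullary using (¬_; Dec; yes; no)
open import Relation.Nullary.Decidable using (⌊_⌋)
open import Relation.Binary.PropositionalEquality using (_≡_)
open import Relation.Binary.Structures using (IsPartialOrder)

sgn : ℕ → ℤ
sgn zero    = + 1
sgn (suc k) = - sgn k

sumℤ : {n : ℕ} → (Fin n → ℤ) → ℤ
sumℤ {zero}  f = + 0
sumℤ {suc n} f = f zero + sumℤ {n} (λ i → f (suc i))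

sumWhere : {n : ℕ} → (Fin n → Bool) → (Fin n → ℤ) → ℤ
sumWhere c f = sumℤ (λ i → if c i then f i else + 0)

record GradedPoset (n : ℕ) : Set₁ where
  field
    _≼_      : Fin n → Fin n → Set
    _≼?_     : (s t : Fin n) → Dec (s ≼ t)
    isPO     : IsPartialOrder _≡_ _≼_
    bot      : Fin n
    top      : Fin n
    bot-min  : ∀ s → bot ≼ s
    top-max  : ∀ s → s ≼ top
    ρ        : Fin n → ℕ
    ρ-bot    : ρ bot ≡ 0
    ρ-cover  : ∀ s t → s ≼ t → ¬ (s ≡ t) →
               (∀ u → s ≼ u → u ≼ t → (u ≡ s) ⊎ (u ≡ t)) →
               ρ t ≡ suc (ρ s)

  rank : ℕ
  rank = ρ top

  lt? : Fin n → Fin n → Bool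
  lt? s t = ⌊ s ≼? t ⌋ ∧ not ⌊ s ≟ t ⌋

  -- Möbius function by the recursion μ(s,s)=1, μ(s,t) = - Σ_{s≤u<t} μ(s,u),
  -- μ(s,t)=0 if s ≰ t; computed with fuel (any fuel > n suffices, since
  -- strict chains in a poset with n elements have fewer than n steps).
  μ′ : ℕ → Fin n → Fin n → ℤ
  μ′ zero    s t = + 0
  μ′ (suc k) s t with s ≟ t | s ≼? t
  ... | yes _ | _     = + 1
  ... | no _  | no _  = + 0
  ... | no _  | yes _ = - sumWhere (λ u → ⌊ s ≼? u ⌋ ∧ lt? u t) (λ u → μ′ k s u)

  μ : Fin n → Fin n → ℤ
  μ = μ′ (suc n)

  e : Fin n → Fin n → ℤ
  e s t = μ s t - sgn (ρ t ∸ ρ s)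

  -- SingI k s t : the interval [s,t] (a graded poset of rank ρ t - ρ s)
  -- is (k-1)-Sing.  k = 0: Eulerian; k = 1: semi-Eulerian;
  -- k ≥ 2: every subinterval of length < ρ t - ρ s (i.e. ≤ d) is (k-2)-Sing.
  SingI : ℕ → Fin n → Fin n → Set
  SingI zero s t =
    ∀ a b → s ≼ a → a ≼ b → b ≼ t → μ a b ≡ sgn (ρ b ∸ ρ a)
  SingI (suc zero) s t =
    ∀ a b → s ≼ a → a ≼ b → b ≼ t → ¬ ((a ≡ s) × (b ≡ t)) →
    μ a b ≡ sgn (ρ b ∸ ρ a)
  SingI (suc (suc k)) s t =
    ∀ a b → s ≼ a → a ≼ b → b ≼ t → ρ b ∸ ρ a < ρ t ∸ ρ s → SingI (suc k) a b

  IsSing : ℕ → Set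
  IsSing j = SingI (suc j) bot top

-- The Möbius function μ is a two-sided inverse of the zeta matrix of P, so summing
-- e(0̂,u) = μ(0̂,u) − (−1)^ρ(u) over all u gives δ(0̂,1̂) − G, where G = Σ_u (−1)^ρ(u), and
-- summing e(u,1̂) gives δ(0̂,1̂) − (−1)^(d+1) G. In a j-Sing poset every interval [a,b] that is
-- more than j ranks shorter than P is Eulerian at its top (shrink [0̂,1̂] around [a,b] one rank at
-- a time along covers, descending one Sing level per step), so e(0̂,u) vanishes unless u = 1̂ or
-- d − j + 1 ≤ ρ(u) ≤ d, and e(u,1̂) vanishes unless u = 0̂ or 1 ≤ ρ(u) ≤ j. Comparing the two
-- totals: for d odd they coincide, for d even δ(0̂,1̂) = 0 and the two G-terms cancel in the sum.
module Submission where

open import Defs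
open import Data.Nat using (ℕ; suc; _≤_; _≤?_; _+_; _%_)
open import Data.Integer using (ℤ; -_; _-_) renaming (_+_ to _+ℤ_; _*_ to _*ℤ_)
open import Data.Bool using (_∧_)
open import Data.Product using (_×_)
open import Relation.Nullary.Decidable using (⌊_⌋)
open import Relation.Binary.PropositionalEquality using (_≡_)

open import Level using (0ℓ)
open import Data.Nat using (zero; _∸_; _<_; z≤n; s≤s; pred)
import Data.Nat.Properties as ℕ
open import Data.Integer using (+_; -1ℤ)
import Data.Integer.Properties as ℤ
open import Data.Integer.Tactic.RingSolver using (solve-∀)
open import Data.Fin using (Fin; zero; suc)
open import Data.Fin.Properties using (_≟_; any?; punchInᵢ≢i)
open import Data.Fin.Induction using (po-wellFounded; po-noetherian)
open import Data.Fin.Subset using (Subset; inside; outside; _∈_; ∣_∣)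
open import Data.Fin.Subset.Properties using (∣p∣≤n; ∣⁅x⁆∣≡1; x∈⁅y⁆⇒x≡y; p⊆q⇒∣p∣≤∣q∣; p⊂q⇒∣p∣<∣q∣)
open import Data.Vec using (tabulate)
open import Data.Vec.Properties using (lookup∘tabulate; lookup⇒[]=; []=⇒lookup)
open import Data.Vec.Functional using (removeAt)
open import Data.Bool using (Bool; true; false; if_then_else_; not)
open import Data.Product using (∃-syntax; _,_; proj₁)
open import Data.Sum using (_⊎_; inj₁; inj₂)
open import Function using (flip; _∘_)
open import Induction.WellFounded using (WellFounded; Acc; acc)
open import Relation.Nullary using (¬_; Dec; yes; no; does)
open import Relation.Nullary.Decidable using (_×-dec_; ¬?; dec-true; dec-false; isYes≗does)
open import Relation.Nullary.Negation using (contradiction)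
open import Relation.Unary using (Pred; Decidable)
open import Relation.Binary.PropositionalEquality using (_≢_; refl; sym; trans; cong; cong₂; subst; module ≡-Reasoning)
open import Relation.Binary.Structures using (IsPartialOrder)
import Relation.Binary.Construct.NonStrictToStrict as ToStrict
open import Algebra.Bundles using (AbelianGroup)
open import Algebra.Properties.Group (AbelianGroup.group ℤ.+-0-abelianGroup) using (∙-cancelʳ)
open import Algebra.Properties.Ring ℤ.+-*-ring using (x[y-z]≈xy-xz)
open import Algebra.Properties.Semiring.Sum ℤ.+-*-semiring
  using (sum; sum-cong-≗; sum-remove; ∑-distrib-+; ∑-comm; sum-replicate-zero; *-distribˡ-sum; *-distribʳ-sum)

sumℤ≡sum : ∀ {n} (f : Fin n → ℤ) → sumℤ f ≡ sum f
sumℤ≡sum {zero}  f = refl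
sumℤ≡sum {suc n} f = cong (_+ℤ_ (f zero)) (sumℤ≡sum (λ i → f (suc i)))

sum-zero : ∀ {n} (f : Fin n → ℤ) → (∀ i → f i ≡ + 0) → sum f ≡ + 0
sum-zero {n} f f≡0 = trans (sum-cong-≗ f≡0) (sum-replicate-zero n)

sum-single : ∀ {n} (f : Fin n → ℤ) (i : Fin n) → (∀ j → j ≢ i → f j ≡ + 0) → sum f ≡ f i
sum-single {suc n} f i f≡0 = begin
  sum f                      ≡⟨ sum-remove f ⟩
  f i +ℤ sum (removeAt f i)  ≡⟨ cong (_+ℤ_ (f i)) (sum-zero _ (λ j → f≡0 _ (punchInᵢ≢i i j))) ⟩
  f i +ℤ + 0                 ≡⟨ ℤ.+-identityʳ (f i) ⟩
  f i                        ∎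
  where open ≡-Reasoning

sum-neg : ∀ {n} (f : Fin n → ℤ) → sum (λ i → - f i) ≡ - sum f
sum-neg f = begin
  sum (λ i → - f i)       ≡⟨ sum-cong-≗ (λ i → sym (ℤ.-1*i≡-i (f i))) ⟩
  sum (λ i → -1ℤ *ℤ f i)  ≡⟨ *-distribˡ-sum -1ℤ f ⟨
  -1ℤ *ℤ sum f            ≡⟨ ℤ.-1*i≡-i (sum f) ⟩
  - sum f                 ∎
  where open ≡-Reasoning

∑-distrib-- : ∀ {n} (f g : Fin n → ℤ) → sum (λ i → f i - g i) ≡ sum f - sum g
∑-distrib-- f g = trans (∑-distrib-+ f (λ i → - g i)) (cong (_+ℤ_ (sum f)) (sum-neg g))

sum-if-cong : ∀ {n p} {C : Pred (Fin n) p} (C? : Decidable C) {f g : Fin n → ℤ} →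
  (∀ i → C i → f i ≡ g i) →
  sum (λ i → if does (C? i) then f i else + 0) ≡ sum (λ i → if does (C? i) then g i else + 0)
sum-if-cong C? f≡g = sum-cong-≗ pointwise
  where
  pointwise : ∀ i → (if does (C? i) then _ else + 0) ≡ (if does (C? i) then _ else + 0)
  pointwise i with C? i
  ... | yes Ci = f≡g i Ci
  ... | no _   = refl

sumWhere≡sum-if : ∀ {n} {c c′ : Fin n → Bool} (f : Fin n → ℤ) → (∀ i → c i ≡ c′ i) →
  sumWhere c f ≡ sum (λ i → if c′ i then f i else + 0)
sumWhere≡sum-if {c = c} f c≡c′ = trans (sumℤ≡sum (λ i → if c i then f i else + 0)) (sum-cong-≗ (λ i → cong (λ b → if b then f i else + 0) (c≡c′ i)))

sum-support : ∀ {n p} {C : Pred (Fin n) p} (C? : Decidable C) (f : Fin n → ℤ) (i : Fin n) →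
  ¬ C i → (∀ j → ¬ C j → j ≢ i → f j ≡ + 0) →
  sum f ≡ sum (λ j → if does (C? j) then f j else + 0) +ℤ f i
sum-support C? f i ¬Ci f≡0 = begin
  sum f                      ≡⟨ sum-cong-≗ split ⟩
  sum (λ j → on j +ℤ off j)  ≡⟨ ∑-distrib-+ on off ⟩
  sum on +ℤ sum off          ≡⟨ cong (_+ℤ_ (sum on)) (sum-single off i off≡0) ⟩
  sum on +ℤ off i            ≡⟨ cong (λ b → sum on +ℤ (if b then + 0 else f i)) (dec-false (C? i) ¬Ci) ⟩
  sum on +ℤ f i              ∎
  where
  open ≡-Reasoning
  on off : Fin _ → ℤ
  on j = if does (C? j) then f j else + 0
  off j = if does (C? j) then + 0 else f j
  split : ∀ j → f j ≡ on j +ℤ off j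
  split j with does (C? j)
  ... | true  = sym (ℤ.+-identityʳ (f j))
  ... | false = sym (ℤ.+-identityˡ (f j))
  off≡0 : ∀ j → j ≢ i → off j ≡ + 0
  off≡0 j j≢i with C? j
  ... | yes _ = refl
  ... | no ¬Cj = f≡0 j ¬Cj j≢i

sgn-∸ : ∀ {p r} → p ≤ r → sgn (r ∸ p) ≡ sgn r *ℤ sgn p
sgn-∸ {r = r} z≤n = sym (ℤ.*-identityʳ (sgn r))
sgn-∸ (s≤s {p} {r} p≤r) = trans (sgn-∸ p≤r) (neg*neg (sgn r) (sgn p))
  where
  neg*neg : ∀ a b → a *ℤ b ≡ - a *ℤ - b
  neg*neg = solve-∀

sgn-% : ∀ k → sgn k ≡ sgn (k % 2)
sgn-% zero          = refl
sgn-% (suc zero)    = refl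
sgn-% (suc (suc k)) = trans (ℤ.neg-involutive (sgn k)) (sgn-% k)

pred-shorter : ∀ {x k L} → x + suc k < L → pred L < L × x + k < pred L
pred-shorter {x} {k} {suc L} x+1+k<1+L = ℕ.n<1+n L , ℕ.≤-trans (ℕ.≤-reflexive (sym (ℕ.+-suc x k))) (ℕ.≤-pred x+1+k<1+L)

-- Covers and ranks in a graded poset

module GradedPosetProperties {n : ℕ} (P : GradedPoset n) where
  open GradedPoset P
  open IsPartialOrder isPO using () renaming (refl to ≼-refl; trans to ≼-trans; antisym to ≼-antisym)

  infix 4 _≺_ _⋖_

  _≺_ : Fin n → Fin n → Set
  _≺_ = ToStrict._<_ _≡_ _≼_

  ≺-wellFounded : WellFounded _≺_
  ≺-wellFounded = po-wellFounded isPO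

  ≻-wellFounded : WellFounded (flip _≺_)
  ≻-wellFounded = po-noetherian isPO

  _⋖_ : Fin n → Fin n → Set
  a ⋖ c = a ≺ c × (∀ u → a ≼ u → u ≼ c → u ≡ a ⊎ u ≡ c)

  ρ-⋖ : ∀ {a c} → a ⋖ c → ρ c ≡ suc (ρ a)
  ρ-⋖ ((a≼c , a≢c) , between) = ρ-cover _ _ a≼c a≢c between

  ⋖-or-between : ∀ {a b} → a ≺ b → a ⋖ b ⊎ ∃[ u ] a ≺ u × u ≺ b
  ⋖-or-between {a} {b} a≺b with any? (λ u → ((a ≼? u) ×-dec ¬? (a ≟ u)) ×-dec ((u ≼? b) ×-dec ¬? (u ≟ b)))
  ... | yes between = inj₂ between
  ... | no ¬between = inj₁ (a≺b , edge)
    where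
    edge : ∀ u → a ≼ u → u ≼ b → u ≡ a ⊎ u ≡ b
    edge u a≼u u≼b with u ≟ a | u ≟ b
    ... | yes u≡a | _       = inj₁ u≡a
    ... | no _    | yes u≡b = inj₂ u≡b
    ... | no u≢a  | no u≢b  = contradiction (u , (a≼u , u≢a ∘ sym) , (u≼b , u≢b)) ¬between

  upper-cover : ∀ {a b} → a ≺ b → ∃[ c ] a ⋖ c × c ≼ b
  upper-cover {a} {b} = go (≺-wellFounded b)
    where
    go : ∀ {b} → Acc _≺_ b → a ≺ b → ∃[ c ] a ⋖ c × c ≼ b
    go (acc rec) a≺b with ⋖-or-between a≺b
    ... | inj₁ a⋖b = _ , a⋖b , ≼-refl
    ... | inj₂ (u , a≺u , u≺b) with go (rec u≺b) a≺u
    ...   | c , a⋖c , c≼u = c , a⋖c , ≼-trans c≼u (proj₁ u≺b)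

  lower-cover : ∀ {a b} → a ≺ b → ∃[ c ] a ≼ c × c ⋖ b
  lower-cover {a} {b} = go (≻-wellFounded a)
    where
    go : ∀ {a} → Acc (flip _≺_) a → a ≺ b → ∃[ c ] a ≼ c × c ⋖ b
    go (acc rec) a≺b with ⋖-or-between a≺b
    ... | inj₁ a⋖b = _ , ≼-refl , a⋖b
    ... | inj₂ (u , a≺u , u≺b) with go (rec a≺u) u≺b
    ...   | c , u≼c , c⋖b = c , ≼-trans (proj₁ a≺u) u≼c , c⋖b

  ρ-mono-≺ : ∀ {a b} → a ≺ b → ρ a < ρ b
  ρ-mono-≺ {a} {b} = go (≻-wellFounded a)
    where
    go : ∀ {a} → Acc (flip _≺_) a → a ≺ b → ρ a < ρ b
    go (acc rec) a≺b with upper-cover a≺b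
    ... | c , a⋖c , c≼b with c ≟ b
    ...   | yes refl = ℕ.≤-reflexive (sym (ρ-⋖ a⋖c))
    ...   | no c≢b   = ℕ.<-trans (ℕ.≤-reflexive (sym (ρ-⋖ a⋖c))) (go (rec (proj₁ a⋖c)) (c≼b , c≢b))

  ρ-mono : ∀ {a b} → a ≼ b → ρ a ≤ ρ b
  ρ-mono {a} {b} a≼b with a ≟ b
  ... | yes refl = ℕ.≤-refl
  ... | no a≢b   = ℕ.<⇒≤ (ρ-mono-≺ (a≼b , a≢b))

  -- The Möbius function

  -- μ is computed with fuel; once the fuel reaches the size of the downset of t, more fuel
  -- no longer changes μ′ k s t, and that size is at most n.
  ↓_ : Fin n → Subset n
  ↓ t = tabulate (λ u → if does (u ≼? t) then inside else outside)

  ∈↓⁺ : ∀ {u t} → u ≼ t → u ∈ ↓ t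
  ∈↓⁺ {u} {t} u≼t = lookup⇒[]= u (↓ t) (trans (lookup∘tabulate _ u)
    (cong (λ b → if b then inside else outside) (dec-true (u ≼? t) u≼t)))

  ∈↓⁻ : ∀ {u t} → u ∈ ↓ t → u ≼ t
  ∈↓⁻ {u} {t} u∈↓t with u ≼? t | trans (sym (lookup∘tabulate (λ v → if does (v ≼? t) then inside else outside) u)) ([]=⇒lookup u∈↓t)
  ... | yes u≼t | _ = u≼t
  ... | no _    | ()

  ∣↓∣-positive : ∀ t → 1 ≤ ∣ ↓ t ∣
  ∣↓∣-positive t = subst (_≤ ∣ ↓ t ∣) (∣⁅x⁆∣≡1 t)
    (p⊆q⇒∣p∣≤∣q∣ λ u∈⁅t⁆ → ∈↓⁺ (subst (_≼ t) (sym (x∈⁅y⁆⇒x≡y t u∈⁅t⁆)) ≼-refl))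

  ∣↓∣-mono-≺ : ∀ {a c} → a ≺ c → ∣ ↓ a ∣ < ∣ ↓ c ∣
  ∣↓∣-mono-≺ (a≼c , a≢c) = p⊂q⇒∣p∣<∣q∣
    ( (λ u∈↓a → ∈↓⁺ (≼-trans (∈↓⁻ u∈↓a) a≼c))
    , _ , ∈↓⁺ ≼-refl , λ c∈↓a → a≢c (≼-antisym a≼c (∈↓⁻ c∈↓a)))

  half-open : Fin n → Fin n → Pred (Fin n) 0ℓ
  half-open s t u = s ≼ u × u ≺ t

  half-open? : ∀ s t → Decidable (half-open s t)
  half-open? s t u = (s ≼? u) ×-dec ((u ≼? t) ×-dec ¬? (u ≟ t))

  half-open?-isYes : ∀ s t u → ⌊ s ≼? u ⌋ ∧ lt? u t ≡ does (half-open? s t u)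
  half-open?-isYes s t u =
    cong₂ _∧_ (isYes≗does (s ≼? u)) (cong₂ _∧_ (isYes≗does (u ≼? t)) (cong not (isYes≗does (u ≟ t))))

  μ′-suc : ∀ k s t → ∣ ↓ t ∣ ≤ k → μ′ k s t ≡ μ′ (suc k) s t
  μ′-suc zero    s t ∣↓t∣≤0 = contradiction ∣↓t∣≤0 (ℕ.<⇒≱ (∣↓∣-positive t))
  μ′-suc (suc k) s t ∣↓t∣≤k with s ≟ t | s ≼? t
  ... | yes _ | _     = refl
  ... | no _  | no _  = refl
  ... | no _  | yes _ = cong -_ (begin
    sumWhere _ (μ′ k s)                                                   ≡⟨ sumWhere≡sum-if _ (half-open?-isYes s t) ⟩
    sum (λ u → if does (half-open? s t u) then μ′ k s u else + 0)         ≡⟨ sum-if-cong (half-open? s t) shorter ⟩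
    sum (λ u → if does (half-open? s t u) then μ′ (suc k) s u else + 0)   ≡⟨ sumWhere≡sum-if _ (half-open?-isYes s t) ⟨
    sumWhere _ (μ′ (suc k) s)                                             ∎)
    where
    open ≡-Reasoning
    shorter : ∀ u → half-open s t u → μ′ k s u ≡ μ′ (suc k) s u
    shorter u (_ , u≺t) = μ′-suc k s u (ℕ.≤-pred (ℕ.≤-trans (∣↓∣-mono-≺ u≺t) ∣↓t∣≤k))

  μ-refl : ∀ s → μ s s ≡ + 1
  μ-refl s with s ≟ s
  ... | yes _  = refl
  ... | no s≢s = contradiction refl s≢s

  μ-≰ : ∀ {s t} → ¬ s ≼ t → μ s t ≡ + 0
  μ-≰ {s} {t} s⋠t with s ≟ t | s ≼? t
  ... | yes refl | _      = contradiction ≼-refl s⋠t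
  ... | no _     | no _   = refl
  ... | no _     | yes s≼t = contradiction s≼t s⋠t

  μ-rec : ∀ {s t} → s ≢ t → s ≼ t → μ s t ≡ - sum (λ u → if does (half-open? s t u) then μ s u else + 0)
  μ-rec {s} {t} s≢t s≼t with s ≟ t | s ≼? t
  ... | yes s≡t | _      = contradiction s≡t s≢t
  ... | no _    | no s⋠t = contradiction s≼t s⋠t
  ... | no _    | yes _  = cong -_ (trans (sumWhere≡sum-if _ (half-open?-isYes s t))
        (sum-if-cong (half-open? s t) (λ u _ → μ′-suc n s u (∣p∣≤n (↓ u)))))

  ζ δ : Fin n → Fin n → ℤ
  ζ s t = if does (s ≼? t) then + 1 else + 0
  δ s t = if does (s ≟ t) then + 1 else + 0

  ζ-≼ : ∀ {s t} → s ≼ t → ζ s t ≡ + 1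
  ζ-≼ {s} {t} s≼t = cong (λ b → if b then + 1 else + 0) (dec-true (s ≼? t) s≼t)

  ζ-⋠ : ∀ {s t} → ¬ s ≼ t → ζ s t ≡ + 0
  ζ-⋠ {s} {t} s⋠t = cong (λ b → if b then + 1 else + 0) (dec-false (s ≼? t) s⋠t)

  δ-refl : ∀ s → δ s s ≡ + 1
  δ-refl s = cong (λ b → if b then + 1 else + 0) (dec-true (s ≟ s) refl)

  δ-≢ : ∀ {s t} → s ≢ t → δ s t ≡ + 0
  δ-≢ {s} {t} s≢t = cong (λ b → if b then + 1 else + 0) (dec-false (s ≟ t) s≢t)

  sum-*δ : ∀ (f : Fin n → ℤ) t → sum (λ u → f u *ℤ δ u t) ≡ f t
  sum-*δ f t = begin
    sum (λ u → f u *ℤ δ u t) ≡⟨ sum-single _ t (λ u u≢t → trans (cong (f u *ℤ_) (δ-≢ u≢t)) (ℤ.*-zeroʳ (f u))) ⟩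
    f t *ℤ δ t t             ≡⟨ cong (f t *ℤ_) (δ-refl t) ⟩
    f t *ℤ + 1               ≡⟨ ℤ.*-identityʳ (f t) ⟩
    f t                      ∎
    where open ≡-Reasoning

  sum-δ* : ∀ s (f : Fin n → ℤ) → sum (λ u → δ s u *ℤ f u) ≡ f s
  sum-δ* s f = begin
    sum (λ u → δ s u *ℤ f u) ≡⟨ sum-single _ s (λ u u≢s → trans (cong (_*ℤ f u) (δ-≢ (u≢s ∘ sym))) (ℤ.*-zeroˡ (f u))) ⟩
    δ s s *ℤ f s             ≡⟨ cong (_*ℤ f s) (δ-refl s) ⟩
    + 1 *ℤ f s               ≡⟨ ℤ.*-identityˡ (f s) ⟩
    f s                      ∎
    where open ≡-Reasoning

  μζ-outside : ∀ {s t u} → ¬ (s ≼ u × u ≼ t) → μ s u *ℤ ζ u t ≡ + 0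
  μζ-outside {s} {t} {u} ¬s≼u≼t = by-cases (s ≼? u) (u ≼? t)
    where
    by-cases : Dec (s ≼ u) → Dec (u ≼ t) → μ s u *ℤ ζ u t ≡ + 0
    by-cases (no s⋠u)  _         = trans (cong (_*ℤ ζ u t) (μ-≰ s⋠u)) (ℤ.*-zeroˡ (ζ u t))
    by-cases (yes _)   (no u⋠t)  = trans (cong (μ s u *ℤ_) (ζ-⋠ u⋠t)) (ℤ.*-zeroʳ (μ s u))
    by-cases (yes s≼u) (yes u≼t) = contradiction (s≼u , u≼t) ¬s≼u≼t

  μ*ζ≡δ : ∀ s t → sum (λ u → μ s u *ℤ ζ u t) ≡ δ s t
  μ*ζ≡δ s t with s ≟ t | s ≼? t
  ... | yes refl | _ = begin
    sum (λ u → μ s u *ℤ ζ u s) ≡⟨ sum-single _ s (λ u u≢s → μζ-outside λ (s≼u , u≼s) → u≢s (≼-antisym u≼s s≼u)) ⟩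
    μ s s *ℤ ζ s s             ≡⟨ cong₂ _*ℤ_ (μ-refl s) (ζ-≼ ≼-refl) ⟩
    + 1                        ∎
    where open ≡-Reasoning
  ... | no _ | no s⋠t = sum-zero (λ u → μ s u *ℤ ζ u t) (λ u → μζ-outside λ (s≼u , u≼t) → s⋠t (≼-trans s≼u u≼t))
  ... | no s≢t | yes s≼t = begin
    sum (λ u → μ s u *ℤ ζ u t)
      ≡⟨ sum-support (half-open? s t) _ t (λ (_ , _ , t≢t) → t≢t refl) off-interval ⟩
    sum (λ u → if does (half-open? s t u) then μ s u *ℤ ζ u t else + 0) +ℤ μ s t *ℤ ζ t t
      ≡⟨ cong₂ _+ℤ_ (sum-if-cong (half-open? s t) (λ u (_ , u≼t , _) → ζ-right u≼t)) (ζ-right ≼-refl) ⟩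
    Σ[s,t⟩ +ℤ μ s t
      ≡⟨ cong (_+ℤ_ Σ[s,t⟩) (μ-rec s≢t s≼t) ⟩
    Σ[s,t⟩ - Σ[s,t⟩
      ≡⟨ ℤ.+-inverseʳ Σ[s,t⟩ ⟩
    + 0 ∎
    where
    open ≡-Reasoning
    Σ[s,t⟩ : ℤ
    Σ[s,t⟩ = sum (λ u → if does (half-open? s t u) then μ s u else + 0)
    ζ-right : ∀ {u} → u ≼ t → μ s u *ℤ ζ u t ≡ μ s u
    ζ-right {u} u≼t = trans (cong (μ s u *ℤ_) (ζ-≼ u≼t)) (ℤ.*-identityʳ (μ s u))
    off-interval : ∀ u → ¬ half-open s t u → u ≢ t → μ s u *ℤ ζ u t ≡ + 0
    off-interval u ¬s≼u≺t u≢t = μζ-outside λ (s≼u , u≼t) → ¬s≼u≺t (s≼u , u≼t , u≢t)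

  μ*-cancel : (X : Fin n → Fin n → ℤ) → (∀ s t → sum (λ u → μ s u *ℤ X u t) ≡ + 0) → ∀ s t → X s t ≡ + 0
  μ*-cancel X μX≡0 s t = go (≻-wellFounded s)
    where
    go : ∀ {s} → Acc (flip _≺_) s → X s t ≡ + 0
    go {s} (acc rec) = begin
      X s t                       ≡⟨ ℤ.*-identityˡ (X s t) ⟨
      + 1 *ℤ X s t                ≡⟨ cong (_*ℤ X s t) (μ-refl s) ⟨
      μ s s *ℤ X s t              ≡⟨ sum-single _ s above ⟨
      sum (λ u → μ s u *ℤ X u t)  ≡⟨ μX≡0 s t ⟩
      + 0                         ∎
      where
      open ≡-Reasoning
      above : ∀ u → u ≢ s → μ s u *ℤ X u t ≡ + 0
      above u u≢s = by-cases (s ≼? u)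
        where
        by-cases : Dec (s ≼ u) → μ s u *ℤ X u t ≡ + 0
        by-cases (yes s≼u) = trans (cong (μ s u *ℤ_) (go (rec (s≼u , u≢s ∘ sym)))) (ℤ.*-zeroʳ (μ s u))
        by-cases (no s⋠u)  = trans (cong (_*ℤ X u t) (μ-≰ s⋠u)) (ℤ.*-zeroˡ (X u t))

  -- A one-sided inverse of the unitriangular ζ is two-sided: apply μ*-cancel to ζμ − δ.
  ζ*μ≡δ : ∀ s t → sum (λ u → ζ s u *ℤ μ u t) ≡ δ s t
  ζ*μ≡δ s t = ℤ.i-j≡0⇒i≡j _ _ (μ*-cancel X μX≡0 s t)
    where
    X : Fin n → Fin n → ℤ
    X u t = sum (λ v → ζ u v *ℤ μ v t) - δ u t
    μX≡0 : ∀ s t → sum (λ u → μ s u *ℤ X u t) ≡ + 0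
    μX≡0 s t = begin
      sum (λ u → μ s u *ℤ X u t)
        ≡⟨ sum-cong-≗ (λ u → x[y-z]≈xy-xz (μ s u) (ζμ u) (δ u t)) ⟩
      sum (λ u → μ s u *ℤ ζμ u - μ s u *ℤ δ u t)
        ≡⟨ ∑-distrib-- (λ u → μ s u *ℤ ζμ u) (λ u → μ s u *ℤ δ u t) ⟩
      sum (λ u → μ s u *ℤ ζμ u) - sum (λ u → μ s u *ℤ δ u t)
        ≡⟨ cong₂ _-_ (sum-cong-≗ (λ u → *-distribˡ-sum (μ s u) (λ v → ζ u v *ℤ μ v t))) (sum-*δ (μ s) t) ⟩
      sum (λ u → sum (λ v → μ s u *ℤ (ζ u v *ℤ μ v t))) - μ s t
        ≡⟨ cong (_- μ s t) (∑-comm (λ u v → μ s u *ℤ (ζ u v *ℤ μ v t))) ⟩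
      sum (λ v → sum (λ u → μ s u *ℤ (ζ u v *ℤ μ v t))) - μ s t
        ≡⟨ cong (_- μ s t) (sum-cong-≗ reassociate) ⟩
      sum (λ v → sum (λ u → μ s u *ℤ ζ u v) *ℤ μ v t) - μ s t
        ≡⟨ cong (_- μ s t) (sum-cong-≗ (λ v → cong (_*ℤ μ v t) (μ*ζ≡δ s v))) ⟩
      sum (λ v → δ s v *ℤ μ v t) - μ s t
        ≡⟨ cong (_- μ s t) (sum-δ* s (λ v → μ v t)) ⟩
      μ s t - μ s t
        ≡⟨ ℤ.+-inverseʳ (μ s t) ⟩
      + 0 ∎
      where
      open ≡-Reasoning
      ζμ : Fin n → ℤ
      ζμ u = sum (λ v → ζ u v *ℤ μ v t)
      reassociate : ∀ v → sum (λ u → μ s u *ℤ (ζ u v *ℤ μ v t)) ≡ sum (λ u → μ s u *ℤ ζ u v) *ℤ μ v t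
      reassociate v = begin
        sum (λ u → μ s u *ℤ (ζ u v *ℤ μ v t))  ≡⟨ sum-cong-≗ (λ u → ℤ.*-assoc (μ s u) (ζ u v) (μ v t)) ⟨
        sum (λ u → μ s u *ℤ ζ u v *ℤ μ v t)    ≡⟨ *-distribʳ-sum (μ v t) (λ u → μ s u *ℤ ζ u v) ⟨
        sum (λ u → μ s u *ℤ ζ u v) *ℤ μ v t    ∎

  sum-μ-from-bot : sum (μ bot) ≡ δ bot top
  sum-μ-from-bot = trans (sum-cong-≗ (λ u → sym (trans (cong (μ bot u *ℤ_) (ζ-≼ (top-max u))) (ℤ.*-identityʳ (μ bot u)))))
                         (μ*ζ≡δ bot top)

  sum-μ-to-top : sum (λ u → μ u top) ≡ δ bot top
  sum-μ-to-top = trans (sum-cong-≗ (λ u → sym (trans (cong (_*ℤ μ u top) (ζ-≼ (bot-min u))) (ℤ.*-identityˡ (μ u top)))))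
                       (ζ*μ≡δ bot top)

  sum-e-from-bot : sum (e bot) ≡ δ bot top - sum (λ u → sgn (ρ u))
  sum-e-from-bot = begin
    sum (λ u → μ bot u - sgn (ρ u ∸ ρ bot))      ≡⟨ ∑-distrib-- (μ bot) (λ u → sgn (ρ u ∸ ρ bot)) ⟩
    sum (μ bot) - sum (λ u → sgn (ρ u ∸ ρ bot))  ≡⟨ cong₂ _-_ sum-μ-from-bot (sum-cong-≗ (λ u → cong (λ r → sgn (ρ u ∸ r)) ρ-bot)) ⟩
    δ bot top - sum (λ u → sgn (ρ u))            ∎
    where open ≡-Reasoning

  sum-e-to-top : sum (λ u → e u top) ≡ δ bot top - sgn rank *ℤ sum (λ u → sgn (ρ u))
  sum-e-to-top = begin
    sum (λ u → μ u top - sgn (rank ∸ ρ u))              ≡⟨ ∑-distrib-- (λ u → μ u top) (λ u → sgn (rank ∸ ρ u)) ⟩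
    sum (λ u → μ u top) - sum (λ u → sgn (rank ∸ ρ u))  ≡⟨ cong₂ _-_ sum-μ-to-top (sum-cong-≗ (λ u → sgn-∸ (ρ-mono (top-max u)))) ⟩
    δ bot top - sum (λ u → sgn rank *ℤ sgn (ρ u))       ≡⟨ cong (_-_ (δ bot top)) (*-distribˡ-sum (sgn rank) (λ u → sgn (ρ u))) ⟨
    δ bot top - sgn rank *ℤ sum (λ u → sgn (ρ u))       ∎
    where open ≡-Reasoning

  -- Sing posets

  shorter⇒≢ : ∀ {s t a b} → ρ b ∸ ρ a < ρ t ∸ ρ s → ¬ (a ≡ s × b ≡ t)
  shorter⇒≢ shorter (refl , refl) = ℕ.n≮n _ shorter

  shrink-interval : ∀ {s t a b} → s ≼ a → b ≼ t → ρ b ∸ ρ a < ρ t ∸ ρ s →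
    ∃[ s′ ] ∃[ t′ ] s ≼ s′ × s′ ≼ a × b ≼ t′ × t′ ≼ t × ρ t′ ∸ ρ s′ ≡ pred (ρ t ∸ ρ s)
  shrink-interval {s} {t} {a} {b} s≼a b≼t shorter with a ≟ s | b ≟ t
  ... | no a≢s | _ =
    let c , s⋖c , c≼a = upper-cover (s≼a , a≢s ∘ sym)
    in c , t , proj₁ (proj₁ s⋖c) , c≼a , b≼t , ≼-refl ,
       trans (cong (ρ t ∸_) (ρ-⋖ s⋖c)) (sym (ℕ.pred[m∸n]≡m∸[1+n] (ρ t) (ρ s)))
  ... | yes refl | no b≢t =
    let c , b≼c , c⋖t = lower-cover (b≼t , b≢t)
    in a , c , ≼-refl , ≼-refl , b≼c , proj₁ (proj₁ c⋖t) ,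
       trans (sym (ℕ.pred[m∸n]≡m∸[1+n] (suc (ρ c)) (ρ a))) (cong (λ r → pred (r ∸ ρ a)) (sym (ρ-⋖ c⋖t)))
  ... | yes refl | yes refl = contradiction (refl , refl) (shorter⇒≢ shorter)

  -- Each unit of slack k shrinks [s,t] by one rank around [a,b] and uses up one Sing level.
  μ≡sgn-on-short : ∀ k {s t a b} → SingI (suc k) s t → s ≼ a → a ≼ b → b ≼ t →
                   (ρ b ∸ ρ a) + k < ρ t ∸ ρ s → μ a b ≡ sgn (ρ b ∸ ρ a)
  μ≡sgn-on-short zero sing s≼a a≼b b≼t short =
    sing _ _ s≼a a≼b b≼t (shorter⇒≢ (ℕ.≤-<-trans (ℕ.m≤m+n _ 0) short))
  μ≡sgn-on-short (suc k) {s} {t} {a} {b} sing s≼a a≼b b≼t short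
    with s′ , t′ , s≼s′ , s′≼a , b≼t′ , t′≼t , len
           ← shrink-interval s≼a b≼t (ℕ.≤-<-trans (ℕ.m≤m+n _ (suc k)) short)
    with shrinks , fits ← pred-shorter short
    = μ≡sgn-on-short k
        (sing s′ t′ s≼s′ (≼-trans s′≼a (≼-trans a≼b b≼t′)) t′≼t (subst (_< ρ t ∸ ρ s) (sym len) shrinks))
        s′≼a a≼b b≼t′ (subst (ρ b ∸ ρ a + k <_) (sym len) fits)

  μ≡sgn⇒e≡0 : ∀ {a b} → μ a b ≡ sgn (ρ b ∸ ρ a) → e a b ≡ + 0
  μ≡sgn⇒e≡0 {a} {b} μ≡sgn = trans (cong (_- sgn (ρ b ∸ ρ a)) μ≡sgn) (ℤ.+-inverseʳ (sgn (ρ b ∸ ρ a)))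

  module _ (j : ℕ) where

    low high : Fin n → Bool
    low  t = ⌊ 1 ≤? ρ t ⌋ ∧ ⌊ ρ t ≤? j ⌋
    high t = ⌊ rank ≤? ρ t + j ⌋ ∧ ⌊ suc (ρ t) ≤? rank ⌋

    Low High : Pred (Fin n) 0ℓ
    Low  t = 1 ≤ ρ t × ρ t ≤ j
    High t = rank ≤ ρ t + j × suc (ρ t) ≤ rank

    low? : Decidable Low
    low? t = (1 ≤? ρ t) ×-dec (ρ t ≤? j)

    high? : Decidable High
    high? t = (rank ≤? ρ t + j) ×-dec (suc (ρ t) ≤? rank)

    module _ (sing : IsSing j) where

      e-from-bot-vanishes : ∀ {u} → ρ u + j < rank → e bot u ≡ + 0
      e-from-bot-vanishes {u} short = μ≡sgn⇒e≡0 (μ≡sgn-on-short j sing ≼-refl (bot-min u) (top-max u)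
        (subst (λ r → ρ u ∸ r + j < rank ∸ r) (sym ρ-bot) short))

      e-to-top-vanishes : ∀ {u} → j < ρ u → e u top ≡ + 0
      e-to-top-vanishes {u} j<ρu = μ≡sgn⇒e≡0 (μ≡sgn-on-short j sing (bot-min u) (top-max u) ≼-refl
        (subst (λ r → rank ∸ ρ u + j < rank ∸ r) (sym ρ-bot)
          (subst (rank ∸ ρ u + j <_) (ℕ.m∸n+n≡m (ρ-mono (top-max u))) (ℕ.+-monoʳ-< (rank ∸ ρ u) j<ρu))))

      sum-e-from-bot-high : sum (e bot) ≡ sumWhere high (e bot) +ℤ e bot top
      sum-e-from-bot-high = begin
        sum (e bot)
          ≡⟨ sum-support high? (e bot) top (λ (_ , rank<rank) → ℕ.n≮n rank rank<rank) not-high ⟩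
        sum (λ u → if does (high? u) then e bot u else + 0) +ℤ e bot top
          ≡⟨ cong (_+ℤ e bot top) (sumWhere≡sum-if (e bot) high-isYes) ⟨
        sumWhere high (e bot) +ℤ e bot top ∎
        where
        open ≡-Reasoning
        high-isYes : ∀ u → high u ≡ does (high? u)
        high-isYes u = cong₂ _∧_ (isYes≗does (rank ≤? ρ u + j)) (isYes≗does (suc (ρ u) ≤? rank))
        not-high : ∀ u → ¬ High u → u ≢ top → e bot u ≡ + 0
        not-high u ¬high u≢top =
          e-from-bot-vanishes (ℕ.≰⇒> λ rank≤ρu+j → ¬high (rank≤ρu+j , ρ-mono-≺ (top-max u , u≢top)))

      sum-e-to-top-low : sum (λ u → e u top) ≡ sumWhere low (λ u → e u top) +ℤ e bot top
      sum-e-to-top-low = begin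
        sum (λ u → e u top)
          ≡⟨ sum-support low? (λ u → e u top) bot (λ (1≤ρbot , _) → ℕ.n≮0 (subst (0 <_) ρ-bot 1≤ρbot)) not-low ⟩
        sum (λ u → if does (low? u) then e u top else + 0) +ℤ e bot top
          ≡⟨ cong (_+ℤ e bot top) (sumWhere≡sum-if (λ u → e u top) low-isYes) ⟨
        sumWhere low (λ u → e u top) +ℤ e bot top ∎
        where
        open ≡-Reasoning
        low-isYes : ∀ u → low u ≡ does (low? u)
        low-isYes u = cong₂ _∧_ (isYes≗does (1 ≤? ρ u)) (isYes≗does (ρ u ≤? j))
        not-low : ∀ u → ¬ Low u → u ≢ bot → e u top ≡ + 0
        not-low u ¬low u≢bot =
          e-to-top-vanishes (ℕ.≰⇒> λ ρu≤j → ¬low (subst (_< ρ u) ρ-bot (ρ-mono-≺ (bot-min u , u≢bot ∘ sym)) , ρu≤j))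


corollary6p11 : {n : ℕ} (P : GradedPoset n) (j : ℕ) → GradedPoset.IsSing P j →
  let open GradedPoset P
      low  = λ t → ⌊ 1 ≤? ρ t ⌋ ∧ ⌊ ρ t ≤? j ⌋
      high = λ t → ⌊ rank ≤? ρ t + j ⌋ ∧ ⌊ suc (ρ t) ≤? rank ⌋
      S₁   = sumWhere low (λ t → e t top)
      S₂   = sumWhere high (λ t → e bot t)
  in (rank % 2 ≡ 1 → Data.Integer.+ 2 *ℤ e bot top ≡ - S₁ - S₂)
   × (rank % 2 ≡ 0 → S₁ ≡ S₂)
corollary6p11 P j sing = odd-rank , even-rank
  where
  open GradedPoset P
  open GradedPosetProperties P
  open ≡-Reasoning

  e₀ G S₁ S₂ : ℤ
  e₀ = e bot top
  G  = sum (λ u → sgn (ρ u))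
  S₁ = sumWhere (low j) (λ t → e t top)
  S₂ = sumWhere (high j) (e bot)

  S₁+e₀ : S₁ +ℤ e₀ ≡ δ bot top - sgn rank *ℤ G
  S₁+e₀ = trans (sym (sum-e-to-top-low j sing)) sum-e-to-top

  S₂+e₀ : S₂ +ℤ e₀ ≡ δ bot top - G
  S₂+e₀ = trans (sym (sum-e-from-bot-high j sing)) sum-e-from-bot

  odd-rank : rank % 2 ≡ 1 → + 2 *ℤ e₀ ≡ - S₁ - S₂
  odd-rank rank-odd = begin
    + 2 *ℤ e₀                                                 ≡⟨ twice e₀ S₁ S₂ ⟩
    (S₁ +ℤ e₀) +ℤ (S₂ +ℤ e₀) - S₁ - S₂                        ≡⟨ cong₂ (λ x y → x +ℤ y - S₁ - S₂) S₁+e₀ S₂+e₀ ⟩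
    (δ bot top - sgn rank *ℤ G) +ℤ (δ bot top - G) - S₁ - S₂  ≡⟨ cong₂ (λ d σ → (d - σ *ℤ G) +ℤ (d - G) - S₁ - S₂) δ≡0 sgn≡-1 ⟩
    (+ 0 - -1ℤ *ℤ G) +ℤ (+ 0 - G) - S₁ - S₂                   ≡⟨ cancel G S₁ S₂ ⟩
    - S₁ - S₂                                                 ∎
    where
    twice : ∀ e a b → + 2 *ℤ e ≡ (a +ℤ e) +ℤ (b +ℤ e) - a - b
    twice = solve-∀
    cancel : ∀ g a b → (+ 0 - -1ℤ *ℤ g) +ℤ (+ 0 - g) - a - b ≡ - a - b
    cancel = solve-∀
    sgn≡-1 : sgn rank ≡ -1ℤ
    sgn≡-1 = trans (sgn-% rank) (cong sgn rank-odd)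
    δ≡0 : δ bot top ≡ + 0
    δ≡0 = δ-≢ λ bot≡top → contradiction (trans (cong (λ t → ρ t % 2) bot≡top) rank-odd)
                                          (subst (λ r → r % 2 ≢ 1) (sym ρ-bot) λ ())

  even-rank : rank % 2 ≡ 0 → S₁ ≡ S₂
  even-rank rank-even = ∙-cancelʳ e₀ S₁ S₂ (begin
    S₁ +ℤ e₀                       ≡⟨ S₁+e₀ ⟩
    δ bot top - sgn rank *ℤ G      ≡⟨ cong (λ σ → δ bot top - σ *ℤ G) (trans (sgn-% rank) (cong sgn rank-even)) ⟩
    δ bot top - + 1 *ℤ G           ≡⟨ cong (λ x → δ bot top - x) (ℤ.*-identityˡ G) ⟩
    δ bot top - G                  ≡⟨ S₂+e₀ ⟨
    S₂ +ℤ e₀                       ∎)
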